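{- For integers $n\ge i\ge 0$, let $D_{n,i}$ be the number of G-Motzkin paths of length $n$ with exactly $i$ $\mathbf{d}$-steps. Then for every integer $n\ge 0$, \[ \sum_{i=0}^{n}(-2)^{i}D_{n,i}=2^{n}\qquad\text{and}\qquad \sum_{i=0}^{n}(-1)^{i}D_{n,i}=\sum_{k=0}^{n}\binom{n}{k}C_k, \] where $C_k=\frac{1}{k+1}\binom{2k}{k}$ is the $k$-th Catalan number.
   Context: A G-Motzkin path of length $n$ is a lattice path from $(0,0)$ to $(n,0)$ that never goes below the $x$-axis and consists of up steps $\mathbf{u}=(1,1)$, down steps $\mathbf{d}=(1,-1)$, horizontal steps $\mathbf{h}=(1,0)$ and vertical steps $\mathbf{v}=(0,-1)$. -}

module Defs where

open import Data.Nat using (ℕ; zero; suc; _+_; _*_; _≤_; _≟_)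
open import Data.Nat.Combinatorics using (_C_)
open import Data.Nat.DivMod using (_/_)
open import Data.List using (List; []; _∷_; length; filter; map; concat; concatMap; sum; upTo)
open import Data.Bool using (Bool; true; false; _∧_)
open import Data.Integer as ℤ using (ℤ)
open import Relation.Nullary using (Dec; does)
open import Relation.Binary.PropositionalEquality using (_≡_)

-- Steps: u = (1,1), d = (1,-1), h = (1,0), v = (0,-1)
data Step : Set where
  u d h v : Step

-- number of steps with horizontal displacement 1 (the length of the path)
xlen : List Step → ℕ
xlen []      = 0
xlen (v ∷ s) = xlen s
xlen (_ ∷ s) = suc (xlen s)

#d : List Step → ℕ
#d []      = 0
#d (d ∷ s) = suc (#d s)
#d (_ ∷ s) = #d s

validFrom : ℕ → List Step → Bool
validFrom zero    []      = true
validFrom (suc _) []      = false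
validFrom k       (u ∷ s) = validFrom (suc k) s
validFrom k       (h ∷ s) = validFrom k s
validFrom zero    (d ∷ s) = false
validFrom (suc k) (d ∷ s) = validFrom k s
validFrom zero    (v ∷ s) = false
validFrom (suc k) (v ∷ s) = validFrom k s


words : ℕ → List (List Step)
words zero    = [] ∷ []
words (suc m) = concatMap (λ w → map (_∷ w) (u ∷ d ∷ h ∷ v ∷ [])) (words m)

wordsUpTo : ℕ → List (List Step)
wordsUpTo m = concatMap words (upTo (suc m))

isGMotzkinWith : ℕ → ℕ → List Step → Bool
isGMotzkinWith n i s = validFrom 0 s ∧ (eqb (xlen s) n ∧ eqb (#d s) i)
  where
  eqb : ℕ → ℕ → Bool
  eqb a b = does (a ≟ b)

count : {A : Set} → (A → Bool) → List A → ℕ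
count p []       = 0
count p (x ∷ xs) with p x
... | true  = suc (count p xs)
... | false = count p xs

-- D n i : number of G-Motzkin paths of length n with exactly i d-steps.
-- Every such path has at most 2n steps (#v + #d ≤ #u ≤ n), so enumerating
-- all words of at most 2n steps is exhaustive.
D : ℕ → ℕ → ℕ
D n i = count (isGMotzkinWith n i) (wordsUpTo (2 * n))

-- Catalan number C_k = binom(2k,k)/(k+1)  (exact division)
catalan : ℕ → ℕ
catalan k = ((2 * k) C k) / suc k

Σ≤ : ℕ → (ℕ → ℤ) → ℤ
Σ≤ zero    f = f 0
Σ≤ (suc n) f = Σ≤ n f ℤ.+ f (suc n)

_^ℤ_ : ℤ → ℕ → ℤ
x ^ℤ zero  = ℤ.+ 1
x ^ℤ suc n = x ℤ.* (x ^ℤ n)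

-- Let F t k m (gMotzkinSum t k m) be the sum of t ^ (number of d-steps) over the G-Motzkin paths of length m
-- that start at height k.  Removing the first step gives F t k 0 = 1,
-- F t 0 (m+1) = F t 1 m + F t 0 m and
-- F t (k+1) (m+1) = F t (k+2) m + t F t k m + F t (k+1) m + F t k (m+1)  (steps u, d, h, v).
-- For t = −2 this forces F t (k+1) m = F t k m, hence F t 0 (m+1) = 2 F t 0 m.
-- For t = −1 Pascal's rule shows that the recurrence is solved by the binomial transform
-- F t k m = Σ_j C(m,j) B k j of the ballot numbers B k j = C(k+2j, j) − C(k+2j, j−1),
-- and B 0 j is the Catalan number C_j.

module Submission where

open import Defs
open import Data.Bool using (Bool; true; false; T; _∧_; if_then_else_)
open import Data.Bool.Properties using (if-eta)
open import Data.List using (List; []; _∷_; _++_; map; concatMap; upTo)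
open import Data.List.Properties using (upTo-∷ʳ)
open import Data.Nat using (ℕ; zero; suc; _∸_; _≤_; _<_; _≟_; _≡ᵇ_; z≤n; s≤s)
import Data.Nat as ℕ
import Data.Nat.Properties as ℕ
open import Data.Nat.DivMod using (_/_; m*n/n≡m)
open import Data.Nat.Combinatorics using (_C_; k>n⇒nCk≡0; nCk≡nC[n∸k]; nC1≡n; nCk+nC[k+1]≡[n+1]C[k+1])
open import Data.Integer using (ℤ; +_; -_; _+_; _*_; _-_; _⊖_)
import Data.Integer.Properties as ℤ
open import Data.Integer.Tactic.RingSolver using (solve-∀)
open import Data.Product using (_×_; _,_; proj₁; proj₂)
open import Relation.Nullary using (does; yes; no)
open import Relation.Nullary.Decidable using (dec-true; dec-false)
open import Relation.Binary.PropositionalEquality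
open import Algebra.Properties.CommutativeSemigroup ℤ.+-commutativeSemigroup using (interchange)
open ≡-Reasoning


Σ∈ : {A : Set} → List A → (A → ℤ) → ℤ
Σ∈ []       f = + 0
Σ∈ (x ∷ xs) f = f x + Σ∈ xs f

module _ {A : Set} where

  Σ∈-cong : ∀ (xs : List A) {f g : A → ℤ} → (∀ x → f x ≡ g x) → Σ∈ xs f ≡ Σ∈ xs g
  Σ∈-cong []       f≗g = refl
  Σ∈-cong (x ∷ xs) f≗g = cong₂ _+_ (f≗g x) (Σ∈-cong xs f≗g)

  Σ∈-zero : ∀ (xs : List A) → Σ∈ xs (λ _ → + 0) ≡ + 0
  Σ∈-zero []       = refl
  Σ∈-zero (x ∷ xs) = trans (ℤ.+-identityˡ _) (Σ∈-zero xs)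

  Σ∈-++ : ∀ (xs ys : List A) (f : A → ℤ) → Σ∈ (xs ++ ys) f ≡ Σ∈ xs f + Σ∈ ys f
  Σ∈-++ []       ys f = sym (ℤ.+-identityˡ _)
  Σ∈-++ (x ∷ xs) ys f = trans (cong (_+_ (f x)) (Σ∈-++ xs ys f)) (sym (ℤ.+-assoc (f x) _ _))

  Σ∈-+ : ∀ (xs : List A) (f g : A → ℤ) → Σ∈ xs (λ x → f x + g x) ≡ Σ∈ xs f + Σ∈ xs g
  Σ∈-+ []       f g = refl
  Σ∈-+ (x ∷ xs) f g =
    trans (cong (_+_ (f x + g x)) (Σ∈-+ xs f g)) (interchange (f x) (g x) (Σ∈ xs f) (Σ∈ xs g))

  Σ∈-*ˡ : ∀ (xs : List A) (c : ℤ) (f : A → ℤ) → Σ∈ xs (λ x → c * f x) ≡ c * Σ∈ xs f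
  Σ∈-*ˡ []       c f = sym (ℤ.*-zeroʳ c)
  Σ∈-*ˡ (x ∷ xs) c f =
    trans (cong (_+_ (c * f x)) (Σ∈-*ˡ xs c f)) (sym (ℤ.*-distribˡ-+ c (f x) _))

  Σ∈-concatMap : ∀ {B : Set} (xs : List B) (g : B → List A) (f : A → ℤ) →
                 Σ∈ (concatMap g xs) f ≡ Σ∈ xs (λ x → Σ∈ (g x) f)
  Σ∈-concatMap []       g f = refl
  Σ∈-concatMap (x ∷ xs) g f =
    trans (Σ∈-++ (g x) (concatMap g xs) f) (cong (_+_ (Σ∈ (g x) f)) (Σ∈-concatMap xs g f))

Σ≤-cong : ∀ n {f g : ℕ → ℤ} → (∀ i → f i ≡ g i) → Σ≤ n f ≡ Σ≤ n g
Σ≤-cong zero    f≗g = f≗g 0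
Σ≤-cong (suc n) f≗g = cong₂ _+_ (Σ≤-cong n f≗g) (f≗g (suc n))

Σ≤-cong-≤ : ∀ n {f g : ℕ → ℤ} → (∀ i → i ≤ n → f i ≡ g i) → Σ≤ n f ≡ Σ≤ n g
Σ≤-cong-≤ zero    f≗g = f≗g 0 z≤n
Σ≤-cong-≤ (suc n) f≗g =
  cong₂ _+_ (Σ≤-cong-≤ n (λ i i≤n → f≗g i (ℕ.m≤n⇒m≤1+n i≤n))) (f≗g (suc n) ℕ.≤-refl)

Σ≤-zero : ∀ n → Σ≤ n (λ _ → + 0) ≡ + 0
Σ≤-zero zero    = refl
Σ≤-zero (suc n) = cong (_+ + 0) (Σ≤-zero n)

Σ≤-+ : ∀ n (f g : ℕ → ℤ) → Σ≤ n (λ i → f i + g i) ≡ Σ≤ n f + Σ≤ n g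
Σ≤-+ zero    f g = refl
Σ≤-+ (suc n) f g =
  trans (cong (_+ (f (suc n) + g (suc n))) (Σ≤-+ n f g)) (interchange (Σ≤ n f) (Σ≤ n g) _ _)

Σ≤-*ˡ : ∀ n (c : ℤ) (f : ℕ → ℤ) → Σ≤ n (λ i → c * f i) ≡ c * Σ≤ n f
Σ≤-*ˡ zero    c f = refl
Σ≤-*ˡ (suc n) c f =
  trans (cong (_+ c * f (suc n)) (Σ≤-*ˡ n c f)) (sym (ℤ.*-distribˡ-+ c (Σ≤ n f) _))

Σ≤-sucˡ : ∀ n (f : ℕ → ℤ) → Σ≤ (suc n) f ≡ f 0 + Σ≤ n (λ i → f (suc i))
Σ≤-sucˡ zero    f = refl
Σ≤-sucˡ (suc n) f = trans (cong (_+ f (suc (suc n))) (Σ≤-sucˡ n f)) (ℤ.+-assoc (f 0) _ _)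

Σ∈-upTo : ∀ n (f : ℕ → ℤ) → Σ∈ (upTo (suc n)) f ≡ Σ≤ n f
Σ∈-upTo zero    f = ℤ.+-identityʳ (f 0)
Σ∈-upTo (suc n) f = begin
  Σ∈ (upTo (suc (suc n))) f
    ≡⟨ cong (λ xs → Σ∈ xs f) (upTo-∷ʳ (suc n)) ⟨
  Σ∈ (upTo (suc n) ++ suc n ∷ []) f
    ≡⟨ Σ∈-++ (upTo (suc n)) (suc n ∷ []) f ⟩
  Σ∈ (upTo (suc n)) f + (f (suc n) + + 0)
    ≡⟨ cong₂ _+_ (Σ∈-upTo n f) (ℤ.+-identityʳ (f (suc n))) ⟩
  Σ≤ n f + f (suc n) ∎

Σ≤-Σ∈-comm : ∀ {A : Set} n (xs : List A) (f : ℕ → A → ℤ) →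
             Σ≤ n (λ i → Σ∈ xs (f i)) ≡ Σ∈ xs (λ x → Σ≤ n (λ i → f i x))
Σ≤-Σ∈-comm n []       f = Σ≤-zero n
Σ≤-Σ∈-comm n (x ∷ xs) f =
  trans (Σ≤-+ n (λ i → f i x) (λ i → Σ∈ xs (f i)))
        (cong (_+_ (Σ≤ n (λ i → f i x))) (Σ≤-Σ∈-comm n xs f))

indicator : Bool → ℤ
indicator true  = + 1
indicator false = + 0

count≡Σ∈-indicator : ∀ {A : Set} (p : A → Bool) xs →
                     + count p xs ≡ Σ∈ xs (λ x → indicator (p x))
count≡Σ∈-indicator p []       = refl
count≡Σ∈-indicator p (x ∷ xs) with p x
... | true  = cong (_+_ (+ 1)) (count≡Σ∈-indicator p xs)
... | false = trans (count≡Σ∈-indicator p xs) (sym (ℤ.+-identityˡ _))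

*-δ≢ : ∀ (x : ℤ) {a i} → a ≢ i → x * indicator (does (a ≟ i)) ≡ + 0
*-δ≢ x {a} {i} a≢i = trans (cong (λ b → x * indicator b) (dec-false (a ≟ i) a≢i)) (ℤ.*-zeroʳ x)

*-δ≡ : ∀ (x : ℤ) a → x * indicator (does (a ≟ a)) ≡ x
*-δ≡ x a = trans (cong (λ b → x * indicator b) (dec-true (a ≟ a) refl)) (ℤ.*-identityʳ x)

Σ≤-δ-beyond : ∀ n a (f : ℕ → ℤ) → n < a →
              Σ≤ n (λ i → f i * indicator (does (a ≟ i))) ≡ + 0
Σ≤-δ-beyond n a f n<a =
  trans (Σ≤-cong-≤ n (λ i i≤n → *-δ≢ (f i) {a} {i} (λ { refl → ℕ.<⇒≱ n<a i≤n })))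
        (Σ≤-zero n)

Σ≤-δ : ∀ n a (f : ℕ → ℤ) → a ≤ n →
       Σ≤ n (λ i → f i * indicator (does (a ≟ i))) ≡ f a
Σ≤-δ zero    zero f z≤n = *-δ≡ (f 0) 0
Σ≤-δ (suc n) a    f a≤1+n with a ≟ suc n
... | yes refl =
  trans (cong₂ _+_ (Σ≤-δ-beyond n (suc n) f ℕ.≤-refl) (*-δ≡ (f (suc n)) (suc n)))
        (ℤ.+-identityˡ (f (suc n)))
... | no a≢1+n =
  trans (cong₂ _+_ (Σ≤-δ n a f (ℕ.m<1+n⇒m≤n (ℕ.≤∧≢⇒< a≤1+n a≢1+n)))
                   (*-δ≢ (f (suc n)) {a} a≢1+n))
        (ℤ.+-identityʳ (f a))


-- Weighted sums over words
weight : ℤ → ℕ → ℕ → List Step → ℤ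
weight t k m w = if validFrom k w then (if xlen w ≡ᵇ m then t ^ℤ #d w else + 0) else + 0

#d≤xlen : ∀ w → #d w ≤ xlen w
#d≤xlen []      = z≤n
#d≤xlen (u ∷ w) = ℕ.m≤n⇒m≤1+n (#d≤xlen w)
#d≤xlen (d ∷ w) = s≤s (#d≤xlen w)
#d≤xlen (h ∷ w) = ℕ.m≤n⇒m≤1+n (#d≤xlen w)
#d≤xlen (v ∷ w) = #d≤xlen w

Σ≤-weighted-indicator : ∀ n (t : ℤ) w →
  Σ≤ n (λ i → t ^ℤ i * indicator (isGMotzkinWith n i w)) ≡ weight t 0 n w
Σ≤-weighted-indicator n t w =
  select (validFrom 0 w) (xlen w ≡ᵇ n)
         (λ eq → subst (#d w ≤_) (ℕ.≡ᵇ⇒≡ (xlen w) n eq) (#d≤xlen w))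
  where
  vanish : Σ≤ n (λ i → t ^ℤ i * + 0) ≡ + 0
  vanish = trans (Σ≤-cong n (λ i → ℤ.*-zeroʳ (t ^ℤ i))) (Σ≤-zero n)

  select : ∀ b c → (T c → #d w ≤ n) →
    Σ≤ n (λ i → t ^ℤ i * indicator (b ∧ (c ∧ does (#d w ≟ i))))
      ≡ (if b then (if c then t ^ℤ #d w else + 0) else + 0)
  select false c     _     = vanish
  select true  false _     = vanish
  select true  true  bound = Σ≤-δ n (#d w) (t ^ℤ_) (bound _)

Σ≤-weighted-D : ∀ (t : ℤ) n →
  Σ≤ n (λ i → t ^ℤ i * + D n i) ≡ Σ∈ (wordsUpTo (2 ℕ.* n)) (weight t 0 n)
Σ≤-weighted-D t n = begin
  Σ≤ n (λ i → t ^ℤ i * + D n i)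
    ≡⟨ Σ≤-cong n (λ i → trans (cong (t ^ℤ i *_) (count≡Σ∈-indicator (isGMotzkinWith n i) ws))
                              (sym (Σ∈-*ˡ ws (t ^ℤ i) _))) ⟩
  Σ≤ n (λ i → Σ∈ ws (λ w → t ^ℤ i * indicator (isGMotzkinWith n i w)))
    ≡⟨ Σ≤-Σ∈-comm n ws _ ⟩
  Σ∈ ws (λ w → Σ≤ n (λ i → t ^ℤ i * indicator (isGMotzkinWith n i w)))
    ≡⟨ Σ∈-cong ws (Σ≤-weighted-indicator n t) ⟩
  Σ∈ ws (weight t 0 n) ∎
  where
  ws : List (List Step)
  ws = wordsUpTo (2 ℕ.* n)

-- The contributions of the steps u, d, h, v from height k + 1 with m + 1 horizontal steps to go.
afterFirstStep : ℤ → (ℕ → ℕ → ℤ) → ℕ → ℕ → ℤ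
afterFirstStep t g k m = g (suc (suc k)) m + (t * g k m + (g (suc k) m + g k (suc m)))

Σ∈-afterFirstStep : ∀ {A : Set} (xs : List A) t (g : A → ℕ → ℕ → ℤ) k m →
  Σ∈ xs (λ x → afterFirstStep t (g x) k m)
    ≡ afterFirstStep t (λ k′ m′ → Σ∈ xs (λ x → g x k′ m′)) k m
Σ∈-afterFirstStep {A} xs t g k m =
  trans (Σ∈-+ xs up _)
        (cong (_+_ (Σ∈ xs up)) (trans (Σ∈-+ xs (λ x → t * down x) _)
                                      (cong₂ _+_ (Σ∈-*ˡ xs t down) (Σ∈-+ xs flat vert))))
  where
  up down flat vert : A → ℤ
  up   x = g x (suc (suc k)) m
  down x = g x k m
  flat x = g x (suc k) m
  vert x = g x k (suc m)

Σ≤-afterFirstStep : ∀ n t (g : ℕ → ℕ → ℕ → ℤ) k m →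
  Σ≤ n (λ i → afterFirstStep t (g i) k m)
    ≡ afterFirstStep t (λ k′ m′ → Σ≤ n (λ i → g i k′ m′)) k m
Σ≤-afterFirstStep n t g k m =
  trans (Σ≤-+ n up _)
        (cong (_+_ (Σ≤ n up)) (trans (Σ≤-+ n (λ i → t * down i) _)
                                     (cong₂ _+_ (Σ≤-*ˡ n t down) (Σ≤-+ n flat vert))))
  where
  up down flat vert : ℕ → ℤ
  up   i = g i (suc (suc k)) m
  down i = g i k m
  flat i = g i (suc k) m
  vert i = g i k (suc m)

firstStep : (List Step → ℤ) → List Step → ℤ
firstStep f w = Σ∈ (u ∷ d ∷ h ∷ v ∷ []) (λ s → f (s ∷ w))

Σ∈-words-suc : ∀ L (f : List Step → ℤ) → Σ∈ (words (suc L)) f ≡ Σ∈ (words L) (firstStep f)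
Σ∈-words-suc L = Σ∈-concatMap (words L) (λ w → map (_∷ w) (u ∷ d ∷ h ∷ v ∷ []))

weightSum : ℤ → ℕ → ℕ → ℕ → ℤ
weightSum t k m L = Σ∈ (words L) (weight t k m)

weight-d : ∀ t k m w → weight t (suc k) (suc m) (d ∷ w) ≡ t * weight t k m w
weight-d t k m w with validFrom k w | xlen w ≡ᵇ m
... | true  | true  = refl
... | true  | false = sym (ℤ.*-zeroʳ t)
... | false | _     = sym (ℤ.*-zeroʳ t)

firstStep-weight-00 : ∀ t w → firstStep (weight t 0 0) w ≡ + 0
firstStep-weight-00 t w =
  cong₂ _+_ (if-eta (validFrom 1 w)) (cong (λ x → + 0 + (x + + 0)) (if-eta (validFrom 0 w)))

firstStep-weight-s0 : ∀ t k w → firstStep (weight t (suc k) 0) w ≡ weight t k 0 w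
firstStep-weight-s0 t k w = begin
  firstStep (weight t (suc k) 0) w
    ≡⟨ cong₂ _+_ (if-eta (validFrom (suc (suc k)) w))
                 (cong₂ _+_ (if-eta (validFrom k w))
                            (cong₂ _+_ (if-eta (validFrom (suc k) w)) (ℤ.+-identityʳ (weight t k 0 w)))) ⟩
  + 0 + (+ 0 + (+ 0 + weight t k 0 w))
    ≡⟨ trans (ℤ.+-identityˡ _) (trans (ℤ.+-identityˡ _) (ℤ.+-identityˡ _)) ⟩
  weight t k 0 w ∎

firstStep-weight-0s : ∀ t m w → firstStep (weight t 0 (suc m)) w ≡ weight t 1 m w + weight t 0 m w
firstStep-weight-0s t m w =
  cong (_+_ (weight t 1 m w)) (trans (ℤ.+-identityˡ _) (ℤ.+-identityʳ _))

firstStep-weight-ss : ∀ t k m w →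
  firstStep (weight t (suc k) (suc m)) w ≡ afterFirstStep t (λ k′ m′ → weight t k′ m′ w) k m
firstStep-weight-ss t k m w =
  cong₂ (λ x y → weight t (suc (suc k)) m w + (x + (weight t (suc k) m w + y)))
        (weight-d t k m w) (ℤ.+-identityʳ _)

module _ (t : ℤ) (L : ℕ) where

  weightSum-00 : weightSum t 0 0 (suc L) ≡ + 0
  weightSum-00 =
    trans (Σ∈-words-suc L _) (trans (Σ∈-cong (words L) (firstStep-weight-00 t)) (Σ∈-zero (words L)))

  weightSum-s0 : ∀ k → weightSum t (suc k) 0 (suc L) ≡ weightSum t k 0 L
  weightSum-s0 k = trans (Σ∈-words-suc L _) (Σ∈-cong (words L) (firstStep-weight-s0 t k))

  weightSum-0s : ∀ m → weightSum t 0 (suc m) (suc L) ≡ weightSum t 1 m L + weightSum t 0 m L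
  weightSum-0s m = begin
    weightSum t 0 (suc m) (suc L)
      ≡⟨ Σ∈-words-suc L _ ⟩
    Σ∈ (words L) (firstStep (weight t 0 (suc m)))
      ≡⟨ Σ∈-cong (words L) (firstStep-weight-0s t m) ⟩
    Σ∈ (words L) (λ w → weight t 1 m w + weight t 0 m w)
      ≡⟨ Σ∈-+ (words L) _ _ ⟩
    weightSum t 1 m L + weightSum t 0 m L ∎

  weightSum-ss : ∀ k m →
    weightSum t (suc k) (suc m) (suc L) ≡ afterFirstStep t (λ k′ m′ → weightSum t k′ m′ L) k m
  weightSum-ss k m = begin
    weightSum t (suc k) (suc m) (suc L)
      ≡⟨ Σ∈-words-suc L _ ⟩
    Σ∈ (words L) (firstStep (weight t (suc k) (suc m)))
      ≡⟨ Σ∈-cong (words L) (firstStep-weight-ss t k m) ⟩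
    Σ∈ (words L) (λ w → afterFirstStep t (λ k′ m′ → weight t k′ m′ w) k m)
      ≡⟨ Σ∈-afterFirstStep (words L) t (λ w k′ m′ → weight t k′ m′ w) k m ⟩
    afterFirstStep t (λ k′ m′ → weightSum t k′ m′ L) k m ∎


-- The first-step recurrence
gMotzkinSum : ℤ → ℕ → ℕ → ℤ
gMotzkinSum t k       zero    = + 1
gMotzkinSum t zero    (suc m) = gMotzkinSum t 1 m + gMotzkinSum t 0 m
gMotzkinSum t (suc k) (suc m) =
  gMotzkinSum t (suc (suc k)) m
    + (t * gMotzkinSum t k m + (gMotzkinSum t (suc k) m + gMotzkinSum t k (suc m)))

double : ℕ → ℕ
double zero    = zero
double (suc n) = suc (suc (double n))

double≡n+n : ∀ n → double n ≡ n ℕ.+ n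
double≡n+n zero    = refl
double≡n+n (suc n) = cong suc (trans (cong suc (double≡n+n n)) (sym (ℕ.+-suc n n)))

2*n≡n+n : ∀ n → 2 ℕ.* n ≡ n ℕ.+ n
2*n≡n+n n = cong (n ℕ.+_) (ℕ.+-identityʳ n)

Σ≤-weightSum : ∀ t k m N → k ℕ.+ double m ≤ N → Σ≤ N (weightSum t k m) ≡ gMotzkinSum t k m
Σ≤-weightSum t zero zero zero _ = refl
Σ≤-weightSum t zero zero (suc N) _ =
  trans (Σ≤-sucˡ N _)
        (cong (_+_ (+ 1)) (trans (Σ≤-cong N (λ L → weightSum-00 t L)) (Σ≤-zero N)))
Σ≤-weightSum t (suc k) zero (suc N) (s≤s bound) = begin
  Σ≤ (suc N) (weightSum t (suc k) 0)
    ≡⟨ trans (Σ≤-sucˡ N _) (ℤ.+-identityˡ _) ⟩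
  Σ≤ N (λ L → weightSum t (suc k) 0 (suc L))
    ≡⟨ Σ≤-cong N (λ L → weightSum-s0 t L k) ⟩
  Σ≤ N (weightSum t k 0)
    ≡⟨ Σ≤-weightSum t k 0 N bound ⟩
  gMotzkinSum t k 0 ∎
Σ≤-weightSum t zero (suc m) (suc N) (s≤s bound) = begin
  Σ≤ (suc N) (weightSum t 0 (suc m))
    ≡⟨ trans (Σ≤-sucˡ N _) (ℤ.+-identityˡ _) ⟩
  Σ≤ N (λ L → weightSum t 0 (suc m) (suc L))
    ≡⟨ Σ≤-cong N (λ L → weightSum-0s t L m) ⟩
  Σ≤ N (λ L → weightSum t 1 m L + weightSum t 0 m L)
    ≡⟨ Σ≤-+ N _ _ ⟩
  Σ≤ N (weightSum t 1 m) + Σ≤ N (weightSum t 0 m)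
    ≡⟨ cong₂ _+_ (Σ≤-weightSum t 1 m N bound)
                 (Σ≤-weightSum t 0 m N (ℕ.<⇒≤ bound)) ⟩
  gMotzkinSum t 1 m + gMotzkinSum t 0 m ∎
Σ≤-weightSum t (suc k) (suc m) (suc N) (s≤s bound) = begin
  Σ≤ (suc N) (weightSum t (suc k) (suc m))
    ≡⟨ trans (Σ≤-sucˡ N _) (ℤ.+-identityˡ _) ⟩
  Σ≤ N (λ L → weightSum t (suc k) (suc m) (suc L))
    ≡⟨ Σ≤-cong N (λ L → weightSum-ss t L k m) ⟩
  Σ≤ N (λ L → afterFirstStep t (λ k′ m′ → weightSum t k′ m′ L) k m)
    ≡⟨ Σ≤-afterFirstStep N t (λ L k′ m′ → weightSum t k′ m′ L) k m ⟩
  afterFirstStep t (λ k′ m′ → Σ≤ N (weightSum t k′ m′)) k m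
    ≡⟨ cong₂ _+_ (Σ≤-weightSum t (suc (suc k)) m N bound₂)
         (cong₂ _+_ (cong (t *_) (Σ≤-weightSum t k m N bound₀))
                    (cong₂ _+_ (Σ≤-weightSum t (suc k) m N bound₁) (Σ≤-weightSum t k (suc m) N bound))) ⟩
  afterFirstStep t (gMotzkinSum t) k m ∎
  where
  bound₂ : suc (suc (k ℕ.+ double m)) ≤ N
  bound₂ = subst (_≤ N) (trans (ℕ.+-suc k (suc (double m))) (cong suc (ℕ.+-suc k (double m)))) bound
  bound₁ : suc k ℕ.+ double m ≤ N
  bound₁ = ℕ.<⇒≤ bound₂
  bound₀ : k ℕ.+ double m ≤ N
  bound₀ = ℕ.<⇒≤ bound₁

Σ≤-weighted-D≡gMotzkinSum : ∀ (t : ℤ) n → Σ≤ n (λ i → t ^ℤ i * + D n i) ≡ gMotzkinSum t 0 n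
Σ≤-weighted-D≡gMotzkinSum t n = begin
  Σ≤ n (λ i → t ^ℤ i * + D n i)
    ≡⟨ Σ≤-weighted-D t n ⟩
  Σ∈ (concatMap words (upTo (suc (2 ℕ.* n)))) (weight t 0 n)
    ≡⟨ Σ∈-concatMap (upTo (suc (2 ℕ.* n))) words (weight t 0 n) ⟩
  Σ∈ (upTo (suc (2 ℕ.* n))) (weightSum t 0 n)
    ≡⟨ Σ∈-upTo (2 ℕ.* n) (weightSum t 0 n) ⟩
  Σ≤ (2 ℕ.* n) (weightSum t 0 n)
    ≡⟨ Σ≤-weightSum t 0 n (2 ℕ.* n) (ℕ.≤-reflexive (trans (double≡n+n n) (sym (2*n≡n+n n)))) ⟩
  gMotzkinSum t 0 n ∎


-- The case t = −2
gMotzkinSum-−2-suc : ∀ k m → gMotzkinSum (- + 2) (suc k) m ≡ gMotzkinSum (- + 2) k m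
gMotzkinSum-−2-suc k zero    = refl
gMotzkinSum-−2-suc k (suc m) = begin
  G (suc (suc k)) m + (- + 2 * G k m + (G (suc k) m + G k (suc m)))
    ≡⟨ cong₂ (λ a b → a + (- + 2 * G k m + (b + G k (suc m))))
             (trans (gMotzkinSum-−2-suc (suc k) m) (gMotzkinSum-−2-suc k m)) (gMotzkinSum-−2-suc k m) ⟩
  G k m + (- + 2 * G k m + (G k m + G k (suc m)))
    ≡⟨ cancel (G k m) (G k (suc m)) ⟩
  G k (suc m) ∎
  where
  G : ℕ → ℕ → ℤ
  G = gMotzkinSum (- + 2)
  cancel : ∀ (x y : ℤ) → x + (- + 2 * x + (x + y)) ≡ y
  cancel = solve-∀

gMotzkinSum-−2 : ∀ n → gMotzkinSum (- + 2) 0 n ≡ (+ 2) ^ℤ n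
gMotzkinSum-−2 zero    = refl
gMotzkinSum-−2 (suc n) = begin
  gMotzkinSum (- + 2) 1 n + gMotzkinSum (- + 2) 0 n
    ≡⟨ cong (_+ gMotzkinSum (- + 2) 0 n) (gMotzkinSum-−2-suc 0 n) ⟩
  gMotzkinSum (- + 2) 0 n + gMotzkinSum (- + 2) 0 n
    ≡⟨ cong (λ x → x + x) (gMotzkinSum-−2 n) ⟩
  (+ 2) ^ℤ n + (+ 2) ^ℤ n
    ≡⟨ twice ((+ 2) ^ℤ n) ⟩
  + 2 * (+ 2) ^ℤ n ∎
  where
  twice : ∀ (x : ℤ) → x + x ≡ + 2 * x
  twice = solve-∀


-- Binomial coefficients and Catalan numbers
absorption : ∀ n k → suc k ℕ.* (suc n C suc k) ≡ suc n ℕ.* (n C k)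
absorption zero    zero    = refl
absorption zero    (suc k)
  rewrite k>n⇒nCk≡0 {1} {suc (suc k)} (s≤s (s≤s z≤n)) | k>n⇒nCk≡0 {0} {suc k} (s≤s z≤n) =
  ℕ.*-zeroʳ (suc (suc k))
absorption (suc n) zero    =
  trans (ℕ.*-identityˡ _) (trans (nC1≡n (suc (suc n))) (sym (ℕ.*-identityʳ (suc (suc n)))))
absorption (suc n) (suc k) = begin
  suc (suc k) ℕ.* (suc (suc n) C suc (suc k))
    ≡⟨ cong (suc (suc k) ℕ.*_) (nCk+nC[k+1]≡[n+1]C[k+1] (suc n) (suc k)) ⟨
  suc (suc k) ℕ.* (A ℕ.+ B)
    ≡⟨ trans (ℕ.*-distribˡ-+ (suc (suc k)) A B) (ℕ.+-assoc A _ _) ⟩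
  A ℕ.+ (suc k ℕ.* A ℕ.+ suc (suc k) ℕ.* B)
    ≡⟨ cong (A ℕ.+_) (cong₂ ℕ._+_ (absorption n k) (absorption n (suc k))) ⟩
  A ℕ.+ (suc n ℕ.* (n C k) ℕ.+ suc n ℕ.* (n C suc k))
    ≡⟨ cong (A ℕ.+_) (trans (sym (ℕ.*-distribˡ-+ (suc n) (n C k) (n C suc k)))
                           (cong (suc n ℕ.*_) (nCk+nC[k+1]≡[n+1]C[k+1] n k))) ⟩
  A ℕ.+ suc n ℕ.* A ∎
  where
  A B : ℕ
  A = suc n C suc k
  B = suc n C suc (suc k)

[m+n]Cm≡[m+n]Cn : ∀ m n → (m ℕ.+ n) C m ≡ (m ℕ.+ n) C n
[m+n]Cm≡[m+n]Cn m n = trans (nCk≡nC[n∸k] (ℕ.m≤m+n m n)) (cong ((m ℕ.+ n) C_) (ℕ.m+n∸m≡n m n))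

choosePred : ℕ → ℕ → ℕ
choosePred M zero    = 0
choosePred M (suc j) = M C j

binomDiff : ℕ → ℕ → ℤ
binomDiff M j = + (M C j) - + choosePred M j

choosePred-suc : ∀ M j → choosePred (suc M) (suc j) ≡ choosePred M j ℕ.+ M C j
choosePred-suc M zero    = refl
choosePred-suc M (suc j) = sym (nCk+nC[k+1]≡[n+1]C[k+1] M j)

binomDiff-suc : ∀ M j → binomDiff (suc M) (suc j) ≡ binomDiff M j + binomDiff M (suc j)
binomDiff-suc M j = begin
  + (suc M C suc j) - + choosePred (suc M) (suc j)
    ≡⟨ cong₂ (λ a b → + a - + b) (sym (nCk+nC[k+1]≡[n+1]C[k+1] M j)) (choosePred-suc M j) ⟩
  + (M C j ℕ.+ M C suc j) - + (choosePred M j ℕ.+ M C j)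
    ≡⟨ cong₂ (λ a b → a - b) (ℤ.pos-+ (M C j) _) (ℤ.pos-+ (choosePred M j) _) ⟩
  (+ (M C j) + + (M C suc j)) - (+ choosePred M j + + (M C j))
    ≡⟨ regroup (+ (M C j)) (+ (M C suc j)) (+ choosePred M j) ⟩
  (+ (M C j) - + choosePred M j) + (+ (M C suc j) - + (M C j)) ∎
  where
  regroup : ∀ (a b p : ℤ) → (a + b) - (p + a) ≡ (a - p) + (b - a)
  regroup = solve-∀

central-ratio : ∀ j → suc j ℕ.* choosePred (j ℕ.+ j) j ≡ j ℕ.* ((j ℕ.+ j) C j)
central-ratio zero    = refl
central-ratio (suc i) rewrite ℕ.+-suc i i = begin
  suc (suc i) ℕ.* (suc (suc (i ℕ.+ i)) C i)
    ≡⟨ cong (suc (suc i) ℕ.*_) ([m+n]Cm≡[m+n]Cn (suc (suc i)) i) ⟨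
  suc (suc i) ℕ.* (suc (suc (i ℕ.+ i)) C suc (suc i))
    ≡⟨ absorption (suc (i ℕ.+ i)) (suc i) ⟩
  suc (suc (i ℕ.+ i)) ℕ.* (suc (i ℕ.+ i) C suc i)
    ≡⟨ cong (suc (suc (i ℕ.+ i)) ℕ.*_) ([m+n]Cm≡[m+n]Cn (suc i) i) ⟩
  suc (suc (i ℕ.+ i)) ℕ.* (suc (i ℕ.+ i) C i)
    ≡⟨ absorption (suc (i ℕ.+ i)) i ⟨
  suc i ℕ.* (suc (suc (i ℕ.+ i)) C suc i) ∎

quotient-by-ratio : ∀ j X Y → suc j ℕ.* Y ≡ j ℕ.* X → X / suc j ≡ X ∸ Y × Y ≤ X
quotient-by-ratio j X Y ratio =
  trans (cong (_/ suc j) (sym X∸Y*[1+j]≡X)) (m*n/n≡m (X ∸ Y) (suc j)) , Y≤X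
  where
  X∸Y*[1+j]≡X : (X ∸ Y) ℕ.* suc j ≡ X
  X∸Y*[1+j]≡X = begin
    (X ∸ Y) ℕ.* suc j
      ≡⟨ ℕ.*-distribʳ-∸ (suc j) X Y ⟩
    X ℕ.* suc j ∸ Y ℕ.* suc j
      ≡⟨ cong₂ _∸_ (ℕ.*-comm X (suc j)) (trans (ℕ.*-comm Y (suc j)) ratio) ⟩
    X ℕ.+ j ℕ.* X ∸ j ℕ.* X
      ≡⟨ ℕ.m+n∸n≡m X (j ℕ.* X) ⟩
    X ∎
  Y≤X : Y ≤ X
  Y≤X = ℕ.*-cancelˡ-≤ (suc j) (subst (_≤ suc j ℕ.* X) (sym ratio) (ℕ.m≤n+m (j ℕ.* X) X))

catalan≡binomDiff : ∀ j → + catalan j ≡ binomDiff (2 ℕ.* j) j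
catalan≡binomDiff j = begin
  + (X / suc j)   ≡⟨ cong +_ (proj₁ quotient) ⟩
  + (X ∸ Y)       ≡⟨ ℤ.⊖-≥ (proj₂ quotient) ⟨
  X ⊖ Y           ≡⟨ ℤ.m-n≡m⊖n X Y ⟨
  + X - + Y       ∎
  where
  X Y : ℕ
  X = (2 ℕ.* j) C j
  Y = choosePred (2 ℕ.* j) j
  ratio : suc j ℕ.* Y ≡ j ℕ.* X
  ratio = subst (λ M → suc j ℕ.* choosePred M j ≡ j ℕ.* (M C j)) (sym (2*n≡n+n j)) (central-ratio j)
  quotient : X / suc j ≡ X ∸ Y × Y ≤ X
  quotient = quotient-by-ratio j X Y ratio

binomialSum : ℕ → (ℕ → ℤ) → ℤ
binomialSum m g = Σ≤ m (λ j → + (m C j) * g j)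

binomialSum-+ : ∀ m (f g : ℕ → ℤ) →
                binomialSum m (λ j → f j + g j) ≡ binomialSum m f + binomialSum m g
binomialSum-+ m f g =
  trans (Σ≤-cong m (λ j → ℤ.*-distribˡ-+ (+ (m C j)) (f j) (g j)))
        (Σ≤-+ m (λ j → + (m C j) * f j) (λ j → + (m C j) * g j))

binomialSum-suc : ∀ m (g : ℕ → ℤ) →
                  binomialSum (suc m) g ≡ binomialSum m g + binomialSum m (λ j → g (suc j))
binomialSum-suc m g = begin
  binomialSum (suc m) g
    ≡⟨ Σ≤-sucˡ m _ ⟩
  + 1 * g 0 + Σ≤ m (λ j → + (suc m C suc j) * g (suc j))
    ≡⟨ cong (_+_ (+ 1 * g 0)) (Σ≤-cong m pascal) ⟩
  + 1 * g 0 + Σ≤ m (λ j → + (m C j) * g (suc j) + + (m C suc j) * g (suc j))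
    ≡⟨ cong (_+_ (+ 1 * g 0)) (Σ≤-+ m _ _) ⟩
  + 1 * g 0 + (shifted + rest)
    ≡⟨ trans (cong (_+_ (+ 1 * g 0)) (ℤ.+-comm shifted rest)) (sym (ℤ.+-assoc (+ 1 * g 0) _ _)) ⟩
  + 1 * g 0 + rest + shifted
    ≡⟨ cong (_+ shifted) extended ⟨
  binomialSum m g + shifted ∎
  where
  shifted rest : ℤ
  shifted = binomialSum m (λ j → g (suc j))
  rest    = Σ≤ m (λ j → + (m C suc j) * g (suc j))
  pascal : ∀ j → + (suc m C suc j) * g (suc j) ≡ + (m C j) * g (suc j) + + (m C suc j) * g (suc j)
  pascal j = begin
    + (suc m C suc j) * g (suc j)
      ≡⟨ cong (λ c → + c * g (suc j)) (nCk+nC[k+1]≡[n+1]C[k+1] m j) ⟨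
    + (m C j ℕ.+ m C suc j) * g (suc j)
      ≡⟨ cong (_* g (suc j)) (ℤ.pos-+ (m C j) (m C suc j)) ⟩
    (+ (m C j) + + (m C suc j)) * g (suc j)
      ≡⟨ ℤ.*-distribʳ-+ (g (suc j)) (+ (m C j)) (+ (m C suc j)) ⟩
    + (m C j) * g (suc j) + + (m C suc j) * g (suc j) ∎
  extended : binomialSum m g ≡ + 1 * g 0 + rest
  extended = begin
    binomialSum m g
      ≡⟨ ℤ.+-identityʳ _ ⟨
    binomialSum m g + + 0
      ≡⟨ cong (λ c → binomialSum m g + + c * g (suc m)) (k>n⇒nCk≡0 (ℕ.n<1+n m)) ⟨
    Σ≤ (suc m) (λ j → + (m C j) * g j)
      ≡⟨ Σ≤-sucˡ m _ ⟩
    + 1 * g 0 + rest ∎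


-- The case t = −1
ballot : ℕ → ℕ → ℤ
ballot k j = binomDiff (k ℕ.+ double j) j

ballot-0-suc : ∀ j → ballot 0 (suc j) ≡ ballot 1 j
ballot-0-suc j = begin
  binomDiff (suc (suc (double j))) (suc j)
    ≡⟨ binomDiff-suc (suc (double j)) j ⟩
  ballot 1 j + binomDiff (suc (double j)) (suc j)
    ≡⟨ cong (λ M → ballot 1 j + binomDiff (suc M) (suc j)) (double≡n+n j) ⟩
  ballot 1 j + binomDiff (suc j ℕ.+ j) (suc j)
    ≡⟨ cong (λ c → ballot 1 j + (+ c - + ((suc j ℕ.+ j) C j))) ([m+n]Cm≡[m+n]Cn (suc j) j) ⟩
  ballot 1 j + (+ ((suc j ℕ.+ j) C j) - + ((suc j ℕ.+ j) C j))
    ≡⟨ trans (cong (_+_ (ballot 1 j)) (ℤ.+-inverseʳ (+ ((suc j ℕ.+ j) C j)))) (ℤ.+-identityʳ _) ⟩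
  ballot 1 j ∎

ballot-suc-suc : ∀ k j → ballot (suc k) (suc j) ≡ ballot (suc (suc k)) j + ballot k (suc j)
ballot-suc-suc k j =
  trans (binomDiff-suc M j) (cong (λ M′ → binomDiff M′ j + ballot k (suc j)) top)
  where
  M : ℕ
  M = k ℕ.+ double (suc j)
  top : k ℕ.+ suc (suc (double j)) ≡ suc (suc (k ℕ.+ double j))
  top = trans (ℕ.+-suc k (suc (double j))) (cong suc (ℕ.+-suc k (double j)))

ballot-0≡catalan : ∀ j → ballot 0 j ≡ + catalan j
ballot-0≡catalan j =
  trans (cong (λ M → binomDiff M j) (trans (double≡n+n j) (sym (2*n≡n+n j))))
        (sym (catalan≡binomDiff j))

gMotzkinSum-−1 : ∀ k m → gMotzkinSum (- + 1) k m ≡ binomialSum m (ballot k)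
gMotzkinSum-−1 k       zero    = refl
gMotzkinSum-−1 zero    (suc m) = begin
  gMotzkinSum (- + 1) 1 m + gMotzkinSum (- + 1) 0 m
    ≡⟨ cong₂ _+_ (gMotzkinSum-−1 1 m) (gMotzkinSum-−1 0 m) ⟩
  binomialSum m (ballot 1) + binomialSum m (ballot 0)
    ≡⟨ ℤ.+-comm (binomialSum m (ballot 1)) (binomialSum m (ballot 0)) ⟩
  binomialSum m (ballot 0) + binomialSum m (ballot 1)
    ≡⟨ cong (_+_ (binomialSum m (ballot 0))) (Σ≤-cong m (λ j → cong (+ (m C j) *_) (ballot-0-suc j))) ⟨
  binomialSum m (ballot 0) + binomialSum m (λ j → ballot 0 (suc j))
    ≡⟨ binomialSum-suc m (ballot 0) ⟨
  binomialSum (suc m) (ballot 0) ∎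
gMotzkinSum-−1 (suc k) (suc m) = begin
  F (suc (suc k)) m + (- + 1 * F k m + (F (suc k) m + F k (suc m)))
    ≡⟨ cong₂ (λ a b → a + (- + 1 * b + (F (suc k) m + F k (suc m))))
             (gMotzkinSum-−1 (suc (suc k)) m) (gMotzkinSum-−1 k m) ⟩
  B (suc (suc k)) + (- + 1 * B k + (F (suc k) m + F k (suc m)))
    ≡⟨ cong₂ (λ a b → B (suc (suc k)) + (- + 1 * B k + (a + b)))
             (gMotzkinSum-−1 (suc k) m)
             (trans (gMotzkinSum-−1 k (suc m)) (binomialSum-suc m (ballot k))) ⟩
  B (suc (suc k)) + (- + 1 * B k + (B (suc k) + (B k + S k)))
    ≡⟨ cancel (B (suc (suc k))) (B k) (B (suc k)) (S k) ⟩
  B (suc k) + (B (suc (suc k)) + S k)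
    ≡⟨ cong (_+_ (B (suc k))) (trans (Σ≤-cong m (λ j → cong (+ (m C j) *_) (ballot-suc-suc k j)))
                                      (binomialSum-+ m (ballot (suc (suc k))) (λ j → ballot k (suc j)))) ⟨
  B (suc k) + S (suc k)
    ≡⟨ binomialSum-suc m (ballot (suc k)) ⟨
  binomialSum (suc m) (ballot (suc k)) ∎
  where
  F : ℕ → ℕ → ℤ
  F = gMotzkinSum (- + 1)
  B S : ℕ → ℤ
  B k′ = binomialSum m (ballot k′)
  S k′ = binomialSum m (λ j → ballot k′ (suc j))
  cancel : ∀ (a b c s : ℤ) → a + (- + 1 * b + (c + (b + s))) ≡ c + (a + s)
  cancel = solve-∀

gMotzkinSum-−1-0 : ∀ n → gMotzkinSum (- + 1) 0 n ≡ Σ≤ n (λ k → + ((n C k) ℕ.* catalan k))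
gMotzkinSum-−1-0 n = begin
  gMotzkinSum (- + 1) 0 n
    ≡⟨ gMotzkinSum-−1 0 n ⟩
  Σ≤ n (λ k → + (n C k) * ballot 0 k)
    ≡⟨ Σ≤-cong n (λ k → cong (+ (n C k) *_) (ballot-0≡catalan k)) ⟩
  Σ≤ n (λ k → + (n C k) * + catalan k)
    ≡⟨ Σ≤-cong n (λ k → ℤ.pos-* (n C k) (catalan k)) ⟨
  Σ≤ n (λ k → + ((n C k) ℕ.* catalan k))    ∎

theorem2p8 : (n : ℕ) →
    (Σ≤ n (λ i → ((- (+ 2)) ^ℤ i) * (+ D n i)) ≡ (+ 2) ^ℤ n)
    × (Σ≤ n (λ i → ((- (+ 1)) ^ℤ i) * (+ D n i)) ≡ Σ≤ n (λ k → + ((n C k) Data.Nat.* catalan k)))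
theorem2p8 n =
    trans (Σ≤-weighted-D≡gMotzkinSum (- + 2) n) (gMotzkinSum-−2 n)
  , trans (Σ≤-weighted-D≡gMotzkinSum (- + 1) n) (gMotzkinSum-−1-0 n)
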